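{- Let $F=(n_F)_{n\ge 0}$ be the Fibonacci sequence, $0_F=0$, $1_F=2_F=1$, $(n+2)_F=(n+1)_F+n_F$. Let $k,n$ be integers with $0\le k\le n$ and put $m=n-k$. Then the layer $\langle \Phi_{k+1}\rightarrow\Phi_n\rangle$ (the $m$ levels $\Phi_{k+1},\dots,\Phi_n$) of the cobweb poset determined by $F$ admits at least one partition into max-disjoint blocks of the form $\sigma P_m$.
   Context: Cobweb poset of a sequence $F=(n_F)_{n\ge0}$ of nonnegative integers: its vertices are arranged in levels $\Phi_s$, $s\ge0$, where $\Phi_0$ consists of a single root vertex and, for $s\ge1$, $\Phi_s=\{(j,s):1\le j\le s_F\}$ has exactly $s_F$ vertices; the partial order is $x<y$ iff the level of $x$ is strictly smaller than the level of $y$ (so in the Hasse diagram every vertex of $\Phi_s$ is joined to every vertex of $\Phi_{s+1}$). For $a\le b$ the layer $\langle\Phi_a\rightarrow\Phi_b\rangle$ is the subposet induced on $\Phi_a\cup\dots\cup\Phi_b$; its maximal chains are exactly the choices of one vertex from each of its levels. For a layer with $m$ levels $\Phi_a,\dots,\Phi_b$ ($m=b-a+1$), a block of the form $\sigma P_m$ is a subposet induced on $V_a\cup\dots\cup V_b$ with $V_i\subseteq\Phi_i$ and $(|V_a|,\dots,|V_b|)=(\sigma(1)_F,\dots,\sigma(m)_F)$ for some permutation $\sigma$ of $\{1,\dots,m\}$ (i.e. a copy of the prime cobweb poset $P_m$ with level sizes $1_F,\dots,m_F$, with its levels permuted; $\sigma$ may differ from block to block). Two blocks are max-disjoint if they have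 no maximal chain in common. A partition of the layer into max-disjoint blocks $\sigma P_m$ is a family of such blocks such that every maximal chain of the layer lies in exactly one block of the family. -}

module Defs where

open import Data.Nat using (ℕ; zero; suc; _+_)
open import Data.Fin using (Fin; toℕ)
open import Data.Fin.Subset using (Subset; _∈_; ∣_∣)
open import Data.Fin.Permutation using (Permutation′; _⟨$⟩ʳ_)
open import Data.Product using (Σ; _×_)
open import Relation.Binary.PropositionalEquality using (_≡_)

fib : ℕ → ℕ
fib zero = 0
fib (suc zero) = 1
fib (suc (suc n)) = fib (suc n) + fib n

-- Level Φ_s (s ≥ 1) of the cobweb poset of F has F s vertices, modelled as Fin (F s).
Level : (F : ℕ → ℕ) → ℕ → Set
Level F s = Fin (F s)

LayerLevel : (F : ℕ → ℕ) (a : ℕ) {m : ℕ} → Fin m → Set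
LayerLevel F a i = Level F (a + toℕ i)

-- A maximal chain of the layer: one vertex from each level.
MaxChain : (F : ℕ → ℕ) (a m : ℕ) → Set
MaxChain F a m = (i : Fin m) → LayerLevel F a i

-- A block of the form σP_m in the layer: subsets V_i of each level Φ_{a+i}
-- with |V_i| = (σ(i+1))_F for a permutation σ of the m positions
-- (positions 0..m-1 here correspond to 1..m in the paper).
record Block (F : ℕ → ℕ) (a m : ℕ) : Set where
  field
    σ     : Permutation′ m
    V     : (i : Fin m) → Subset (F (a + toℕ i))
    sizes : (i : Fin m) → ∣ V i ∣ ≡ F (suc (toℕ (σ ⟨$⟩ʳ i)))

_inBlock_ : {F : ℕ → ℕ} {a m : ℕ} → MaxChain F a m → Block F a m → Set
_inBlock_ {m = m} c B = (i : Fin m) → c i ∈ Block.V B i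

-- A partition of the layer into max-disjoint blocks σP_m: a finite family
-- (indexed by Fin N) of blocks such that every maximal chain lies in exactly
-- one block of the family.
IsBlockPartition : (F : ℕ → ℕ) (a m : ℕ) {N : ℕ} → (Fin N → Block F a m) → Set
IsBlockPartition F a m {N} blocks =
  (c : MaxChain F a m) →
    Σ (Fin N) λ j → (c inBlock blocks j) × ((j′ : Fin N) → c inBlock blocks j′ → j′ ≡ j)

HasBlockPartition : (F : ℕ → ℕ) (a m : ℕ) → Set
HasBlockPartition F a m = Σ ℕ λ N → Σ (Fin N → Block F a m) λ blocks → IsBlockPartition F a m blocks

module Submission where

-- The layer ⟨Φ_{k+1} → Φ_{k+m}⟩ is a box whose sides are the Fibonacci
-- numbers F_{k+1}, …, F_{k+m}; its maximal chains are the points of the box.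
-- A partition into max-disjoint blocks σP_m is a tiling of this box by
-- sub-boxes whose side lengths are a permutation of F_1, …, F_m.
--
-- We build such tilings by induction on k (and, inside the step, on m).
-- For k = 0 the box is itself a single tile.  For the step, view the box
-- (F_{k+2}, …, F_{k+m+2}) with its last side moved to the front and split
-- that side by the addition law  F_{k+m+2} = F_{k+2}·F_{m+1} + F_m·F_{k+1}:
-- the F_{k+2} slabs (F_{m+1}, F_{k+2}, …, F_{k+m+1}) are tiled by extending a
-- tiling of the box (F_{k+2}, …, F_{k+m+1}) by a full side F_{m+1}, and
-- the F_m slabs (F_{k+1}, …, F_{k+m+1}) are tiled by the case k.

open import Defs
open import Data.Nat using (ℕ; zero; suc; _+_; _*_; _≤_; _∸_)
open import Data.Nat.Properties using (+-identityʳ; +-suc)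
open import Data.Nat.Tactic.RingSolver using (solve-∀)
open import Data.Fin using (Fin; zero; suc; toℕ; _↑ˡ_; _↑ʳ_; splitAt; join)
open import Data.Fin.Properties using (splitAt-join; join-splitAt)
open import Data.Fin.Subset using (Subset; _∈_; ∣_∣; ⊤; ⊥; inside; outside)
open import Data.Fin.Subset.Properties using (∈⊤; ∉⊥; ∣⊤∣≡n; ∣⊥∣≡0)
open import Data.Fin.Permutation using (Permutation′; _⟨$⟩ʳ_; lift₀; id; swap; _∘ₚ_)
open import Data.Vec using (Vec; []; _∷_; _++_; _∷ʳ_; lookup; tabulate)
open import Data.Vec.Properties using (lookup∘tabulate; lookup-++ˡ; lookup-++ʳ; []=⇒lookup; lookup⇒[]=)
open import Data.Product using (Σ; _×_; _,_; proj₁; proj₂)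
open import Data.Sum using (_⊎_; inj₁; inj₂)
open import Data.Empty using (⊥-elim)
open import Relation.Nullary using (¬_)
open import Relation.Binary.PropositionalEquality using (_≡_; refl; sym; trans; cong; cong₂; subst; subst₂; module ≡-Reasoning)
open import Function using (_∘_)

private
  variable
    m n : ℕ
    x y : ℕ
    A : Set

-- Permutations of vectors

-- An inductive "is a rearrangement of" relation on vectors, convenient to
-- build; it is interpreted as an honest permutation of positions below.
infix 4 _↭_
data _↭_ {A : Set} : Vec A n → Vec A n → Set where
  ↭-refl  : {xs : Vec A n} → xs ↭ xs
  ↭-prep  : {xs ys : Vec A n} (a : A) → xs ↭ ys → (a ∷ xs) ↭ (a ∷ ys)
  ↭-swap  : {xs ys : Vec A n} (a b : A) → xs ↭ ys → (a ∷ b ∷ xs) ↭ (b ∷ a ∷ ys)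
  ↭-trans : {xs ys zs : Vec A n} → xs ↭ ys → ys ↭ zs → xs ↭ zs

∷↭∷ʳ : (a : A) (xs : Vec A n) → (a ∷ xs) ↭ (xs ∷ʳ a)
∷↭∷ʳ a []       = ↭-refl
∷↭∷ʳ a (b ∷ xs) = ↭-trans (↭-swap a b ↭-refl) (↭-prep b (∷↭∷ʳ a xs))

↭⇒permutation : {xs ys : Vec A n} → xs ↭ ys →
  Σ (Permutation′ n) λ σ → ∀ i → lookup xs i ≡ lookup ys (σ ⟨$⟩ʳ i)
↭⇒permutation ↭-refl = id , λ _ → refl
↭⇒permutation (↭-prep a p) with ↭⇒permutation p
... | σ , e = lift₀ σ , λ { zero → refl ; (suc i) → e i }
↭⇒permutation (↭-swap a b p) with ↭⇒permutation p
... | σ , e = swap σ , λ { zero → refl ; (suc zero) → refl ; (suc (suc i)) → e i }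
↭⇒permutation (↭-trans p q) with ↭⇒permutation p | ↭⇒permutation q
... | σ , e | τ , f = σ ∘ₚ τ , λ i → trans (e i) (f (σ ⟨$⟩ʳ i))

-- Fibonacci numbers

fib-add : ∀ a m → fib (suc a + m) ≡ fib (suc a) * fib (suc m) + fib m * fib a
fib-add zero          m = base₀ (fib (suc m)) (fib m)
  where
  base₀ : ∀ p q → p ≡ 1 * p + q * 0
  base₀ = solve-∀
fib-add (suc zero)    m = base₁ (fib (suc m)) (fib m)
  where
  base₁ : ∀ p q → p + q ≡ 1 * p + q * 1
  base₁ = solve-∀
fib-add (suc (suc a)) m = begin
  fib (suc (suc a) + m) + fib (suc a + m)
    ≡⟨ cong₂ _+_ (fib-add (suc a) m) (fib-add a m) ⟩
  (F₂ * p + q * F₁) + (F₁ * p + q * F₀)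
    ≡⟨ regroup F₂ F₁ F₀ p q ⟩
  (F₂ + F₁) * p + q * (F₁ + F₀) ∎
  where
  open ≡-Reasoning
  F₀ = fib a
  F₁ = fib (suc a)
  F₂ = fib (suc (suc a))
  p = fib (suc m)
  q = fib m
  regroup : ∀ f₂ f₁ f₀ p q → (f₂ * p + q * f₁) + (f₁ * p + q * f₀) ≡ (f₂ + f₁) * p + q * (f₁ + f₀)
  regroup = solve-∀

fibs : ℕ → (m : ℕ) → Vec ℕ m
fibs k zero    = []
fibs k (suc m) = fib (suc k) ∷ fibs (suc k) m

fibs-∷ʳ : ∀ k m → fibs k (suc m) ≡ fibs k m ∷ʳ fib (suc k + m)
fibs-∷ʳ k zero    = cong (λ j → fib j ∷ []) (sym (+-identityʳ (suc k)))
fibs-∷ʳ k (suc m) = cong (fib (suc k) ∷_)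
  (trans (fibs-∷ʳ (suc k) m)
    (cong (λ j → fibs (suc k) m ∷ʳ fib j) (sym (+-suc (suc k) m))))

tabulate-fibs : ∀ k m (D : Fin m → ℕ) → (∀ i → D i ≡ fib (suc k + toℕ i)) → tabulate D ≡ fibs k m
tabulate-fibs k zero    D h = refl
tabulate-fibs k (suc m) D h =
  cong₂ _∷_ (trans (h zero) (cong fib (+-identityʳ (suc k))))
    (tabulate-fibs (suc k) m (λ i → D (suc i))
      (λ i → trans (h (suc i)) (cong fib (+-suc (suc k) (toℕ i)))))

-- Boxes, sub-boxes and tilings

data Point : Vec ℕ m → Set where
  []  : Point []
  _∷_ : {d : ℕ} {ds : Vec ℕ m} → Fin d → Point ds → Point (d ∷ ds)

-- A sub-box: a subset of every side (a "combinatorial" box, not an interval).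
data SubBox : Vec ℕ m → Set where
  []  : SubBox []
  _∷_ : {d : ℕ} {ds : Vec ℕ m} → Subset d → SubBox ds → SubBox (d ∷ ds)

sides : {ds : Vec ℕ m} → SubBox ds → Vec ℕ m
sides []      = []
sides (V ∷ S) = ∣ V ∣ ∷ sides S

infix 4 _∈ᵇ_
data _∈ᵇ_ : {ds : Vec ℕ m} → Point ds → SubBox ds → Set where
  []  : [] ∈ᵇ []
  _∷_ : {d : ℕ} {ds : Vec ℕ m} {a : Fin d} {c : Point ds} {V : Subset d} {S : SubBox ds} →
        a ∈ V → c ∈ᵇ S → (a ∷ c) ∈ᵇ (V ∷ S)

-- A tile of shape t: a sub-box whose side lengths rearrange t.  Tiles are
-- the blocks σP_m of the paper once the box is identified with a layer.
record Tile (t ds : Vec ℕ m) : Set where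
  constructor tile
  field
    box   : SubBox ds
    shape : sides box ↭ t
open Tile

UniquelyIn : {I : Set} {t ds : Vec ℕ m} → (I → Tile t ds) → Point ds → Set
UniquelyIn {I = I} bs c = Σ I λ j → c ∈ᵇ box (bs j) × (∀ j′ → c ∈ᵇ box (bs j′) → j′ ≡ j)

Covers : {I : Set} {t ds : Vec ℕ m} → (I → Tile t ds) → Set
Covers {ds = ds} bs = (c : Point ds) → UniquelyIn bs c

record Tiling (t ds : Vec ℕ m) : Set where
  constructor tiling
  field
    size   : ℕ
    tiles  : Fin size → Tile t ds
    covers : Covers tiles

pullback : {I : Set} {t es : Vec ℕ n} {t′ ds : Vec ℕ m} {bs : I → Tile t es} → Covers bs →
  (f : Point ds → Point es) (g : Tile t es → Tile t′ ds) →
  (∀ c B → c ∈ᵇ box (g B) → f c ∈ᵇ box B) → (∀ c B → f c ∈ᵇ box B → c ∈ᵇ box (g B)) →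
  Covers (λ j → g (bs j))
pullback cover f g forward backward c with cover (f c)
... | j , c∈ , unique = j , backward c _ c∈ , λ j′ c∈′ → unique j′ (forward c _ c∈′)

reindex : {I J : Set} {t ds : Vec ℕ m} {bs : I → Tile t ds} → Covers bs →
  (f : J → I) (g : I → J) → (∀ i → f (g i) ≡ i) → (∀ j → g (f j) ≡ j) →
  Covers (λ j → bs (f j))
reindex {bs = bs} cover f g fg gf c with cover c
... | i , c∈ , unique = g i , subst (λ i′ → c ∈ᵇ box (bs i′)) (sym (fg i)) c∈ ,
  λ j′ c∈′ → trans (sym (gf j′)) (cong g (unique (f j′) c∈′))

full : (ds : Vec ℕ m) → SubBox ds
full []       = []
full (d ∷ ds) = ⊤ ∷ full ds

sides-full : (ds : Vec ℕ m) → sides (full ds) ≡ ds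
sides-full []       = refl
sides-full (d ∷ ds) = cong₂ _∷_ (∣⊤∣≡n d) (sides-full ds)

∈ᵇ-full : {ds : Vec ℕ m} (c : Point ds) → c ∈ᵇ full ds
∈ᵇ-full []      = []
∈ᵇ-full (a ∷ c) = ∈⊤ ∷ ∈ᵇ-full c

single : {t ds : Vec ℕ m} → ds ↭ t → Tiling t ds
single {ds = ds} p = tiling 1 (λ _ → tile (full ds) (subst (_↭ _) (sym (sides-full ds)) p))
  (λ c → zero , ∈ᵇ-full c , λ { zero _ → refl })

empty : {t : Vec ℕ (suc m)} {ds : Vec ℕ m} → Tiling t (0 ∷ ds)
empty = tiling 0 (λ ()) λ { (() ∷ _) }

reshape : {t t′ ds : Vec ℕ m} → t ↭ t′ → Tiling t ds → Tiling t′ ds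
reshape p (tiling N bs cover) =
  tiling N (λ j → tile (box (bs j)) (↭-trans (shape (bs j)) p)) cover

extend : {t ds : Vec ℕ m} → Tiling t ds → Tiling (x ∷ t) (x ∷ ds)
extend {x = x} {t = t} {ds = ds} (tiling N bs cover) = tiling N (λ j → grow (bs j))
  (pullback {bs = bs} cover tail grow (λ { _ _ (_ ∷ c∈) → c∈ }) (λ { (a ∷ _) _ c∈ → ∈⊤ ∷ c∈ }))
  where
  tail : Point (x ∷ ds) → Point ds
  tail (_ ∷ c) = c
  grow : Tile t ds → Tile (x ∷ t) (x ∷ ds)
  grow (tile S p) = tile (⊤ ∷ S) (subst (λ s → (s ∷ sides S) ↭ (x ∷ t)) (sym (∣⊤∣≡n x)) (↭-prep x p))

∣++∣ : (V : Subset x) (W : Subset y) → ∣ V ++ W ∣ ≡ ∣ V ∣ + ∣ W ∣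
∣++∣ []            W = refl
∣++∣ (outside ∷ V) W = ∣++∣ V W
∣++∣ (inside ∷ V)  W = cong suc (∣++∣ V W)

∈-++ˡ : (a : Fin x) (V : Subset x) (W : Subset y) → a ∈ V → (a ↑ˡ y) ∈ (V ++ W)
∈-++ˡ a V W a∈ = lookup⇒[]= _ _ (trans (lookup-++ˡ V W a) ([]=⇒lookup a∈))

∈-++ˡ⁻ : (a : Fin x) (V : Subset x) (W : Subset y) → (a ↑ˡ y) ∈ (V ++ W) → a ∈ V
∈-++ˡ⁻ a V W a∈ = lookup⇒[]= _ _ (trans (sym (lookup-++ˡ V W a)) ([]=⇒lookup a∈))

∈-++ʳ : (b : Fin y) (V : Subset x) (W : Subset y) → b ∈ W → (x ↑ʳ b) ∈ (V ++ W)
∈-++ʳ b V W b∈ = lookup⇒[]= _ _ (trans (lookup-++ʳ V W b) ([]=⇒lookup b∈))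

∈-++ʳ⁻ : (b : Fin y) (V : Subset x) (W : Subset y) → (x ↑ʳ b) ∈ (V ++ W) → b ∈ W
∈-++ʳ⁻ b V W b∈ = lookup⇒[]= _ _ (trans (sym (lookup-++ʳ V W b)) ([]=⇒lookup b∈))

data SplitView (x y : ℕ) : Fin (x + y) → Set where
  left  : (a : Fin x) → SplitView x y (a ↑ˡ y)
  right : (b : Fin y) → SplitView x y (x ↑ʳ b)

splitView : ∀ x y (z : Fin (x + y)) → SplitView x y z
splitView zero    y z       = right z
splitView (suc x) y zero    = left zero
splitView (suc x) y (suc z) with splitView x y z
... | left a  = left (suc a)
... | right b = right b

padˡ : {t : Vec ℕ (suc m)} {ds : Vec ℕ m} → Tile t (x ∷ ds) → Tile t (x + y ∷ ds)
padˡ {y = y} {t = t} (tile (V ∷ S) p) = tile ((V ++ ⊥) ∷ S) (subst (λ s → (s ∷ sides S) ↭ t) (sym size) p)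
  where
  size : ∣ V ++ ⊥ {y} ∣ ≡ ∣ V ∣
  size = trans (∣++∣ V ⊥)
           (trans (cong (∣ V ∣ +_) (∣⊥∣≡0 y)) (+-identityʳ ∣ V ∣))

padʳ : {t : Vec ℕ (suc m)} {ds : Vec ℕ m} → Tile t (y ∷ ds) → Tile t (x + y ∷ ds)
padʳ {x = x} {t = t} (tile (W ∷ S) p) = tile ((⊥ ++ W) ∷ S) (subst (λ s → (s ∷ sides S) ↭ t) (sym size) p)
  where
  size : ∣ ⊥ {x} ++ W ∣ ≡ ∣ W ∣
  size = trans (∣++∣ (⊥ {x}) W) (cong (_+ ∣ W ∣) (∣⊥∣≡0 x))

padˡ⁺ : {t : Vec ℕ (suc m)} {ds : Vec ℕ m} {a : Fin x} {c : Point ds} (B : Tile t (x ∷ ds)) →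
  (a ∷ c) ∈ᵇ box B → ((a ↑ˡ y) ∷ c) ∈ᵇ box (padˡ {y = y} B)
padˡ⁺ (tile (V ∷ S) _) (a∈ ∷ c∈) = ∈-++ˡ _ V ⊥ a∈ ∷ c∈

padˡ⁻ : {t : Vec ℕ (suc m)} {ds : Vec ℕ m} {a : Fin x} {c : Point ds} (B : Tile t (x ∷ ds)) →
  ((a ↑ˡ y) ∷ c) ∈ᵇ box (padˡ {y = y} B) → (a ∷ c) ∈ᵇ box B
padˡ⁻ (tile (V ∷ S) _) (a∈ ∷ c∈) = ∈-++ˡ⁻ _ V ⊥ a∈ ∷ c∈

padʳ⁺ : {t : Vec ℕ (suc m)} {ds : Vec ℕ m} {b : Fin y} {c : Point ds} (B : Tile t (y ∷ ds)) →
  (b ∷ c) ∈ᵇ box B → ((x ↑ʳ b) ∷ c) ∈ᵇ box (padʳ {x = x} B)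
padʳ⁺ (tile (W ∷ S) _) (b∈ ∷ c∈) = ∈-++ʳ _ ⊥ W b∈ ∷ c∈

padʳ⁻ : {t : Vec ℕ (suc m)} {ds : Vec ℕ m} {b : Fin y} {c : Point ds} (B : Tile t (y ∷ ds)) →
  ((x ↑ʳ b) ∷ c) ∈ᵇ box (padʳ {x = x} B) → (b ∷ c) ∈ᵇ box B
padʳ⁻ (tile (W ∷ S) _) (b∈ ∷ c∈) = ∈-++ʳ⁻ _ ⊥ W b∈ ∷ c∈

padˡ-miss : {t : Vec ℕ (suc m)} {ds : Vec ℕ m} {b : Fin y} {c : Point ds} (B : Tile t (x ∷ ds)) →
  ¬ ((x ↑ʳ b) ∷ c) ∈ᵇ box (padˡ {y = y} B)
padˡ-miss (tile (V ∷ S) _) (b∈ ∷ _) = ∉⊥ (∈-++ʳ⁻ _ V ⊥ b∈)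

padʳ-miss : {t : Vec ℕ (suc m)} {ds : Vec ℕ m} {a : Fin x} {c : Point ds} (B : Tile t (y ∷ ds)) →
  ¬ ((a ↑ˡ y) ∷ c) ∈ᵇ box (padʳ {x = x} B)
padʳ-miss (tile (W ∷ S) _) (a∈ ∷ _) = ∉⊥ (∈-++ˡ⁻ _ ⊥ W a∈)

glue : {I J : Set} {t : Vec ℕ (suc m)} {ds : Vec ℕ m} →
  (I → Tile t (x ∷ ds)) → (J → Tile t (y ∷ ds)) → I ⊎ J → Tile t (x + y ∷ ds)
glue {y = y} bs₁ bs₂ (inj₁ j) = padˡ {y = y} (bs₁ j)
glue {x = x} bs₁ bs₂ (inj₂ j) = padʳ {x = x} (bs₂ j)

glue-covers : {I J : Set} {t : Vec ℕ (suc m)} {ds : Vec ℕ m}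
  {bs₁ : I → Tile t (x ∷ ds)} {bs₂ : J → Tile t (y ∷ ds)} → Covers bs₁ → Covers bs₂ →
  Covers (glue bs₁ bs₂)
glue-covers {x = x} {y} {bs₁ = bs₁} {bs₂} cover₁ cover₂ (z ∷ c) = go (splitView x y z)
  where
  go : ∀ {z} → SplitView x y z → UniquelyIn (glue bs₁ bs₂) (z ∷ c)
  go (left a) with cover₁ (a ∷ c)
  ... | j , a∈ , unique = inj₁ j , padˡ⁺ (bs₁ j) a∈ , λ
    { (inj₁ j′) a∈′ → cong inj₁ (unique j′ (padˡ⁻ (bs₁ j′) a∈′))
    ; (inj₂ j′) a∈′ → ⊥-elim (padʳ-miss (bs₂ j′) a∈′) }
  go (right b) with cover₂ (b ∷ c)
  ... | j , b∈ , unique = inj₂ j , padʳ⁺ (bs₂ j) b∈ , λ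
    { (inj₁ j′) b∈′ → ⊥-elim (padˡ-miss (bs₁ j′) b∈′)
    ; (inj₂ j′) b∈′ → cong inj₂ (unique j′ (padʳ⁻ (bs₂ j′) b∈′)) }

union : {t : Vec ℕ (suc m)} {ds : Vec ℕ m} → Tiling t (x ∷ ds) → Tiling t (y ∷ ds) → Tiling t (x + y ∷ ds)
union (tiling N₁ bs₁ cover₁) (tiling N₂ bs₂ cover₂) =
  tiling (N₁ + N₂) (λ j → glue bs₁ bs₂ (splitAt N₁ j))
    (reindex {bs = glue bs₁ bs₂} (glue-covers cover₁ cover₂)
      (splitAt N₁) (join N₁ N₂) (splitAt-join N₁ N₂) (join-splitAt N₁ N₂))

copies : {t : Vec ℕ (suc m)} {ds : Vec ℕ m} (n : ℕ) → Tiling t (x ∷ ds) → Tiling t (n * x ∷ ds)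
copies zero    T = empty
copies (suc n) T = union T (copies n T)

rotate-point : (d : ℕ) (ds : Vec ℕ m) → Point (ds ∷ʳ d) → Point (d ∷ ds)
rotate-point d []       (a ∷ []) = a ∷ []
rotate-point d (e ∷ es) (b ∷ c) with rotate-point d es c
... | a ∷ c′ = a ∷ b ∷ c′

rotate-box : (d : ℕ) (ds : Vec ℕ m) → SubBox (d ∷ ds) → SubBox (ds ∷ʳ d)
rotate-box d []       (V ∷ [])    = V ∷ []
rotate-box d (e ∷ es) (V ∷ W ∷ S) = W ∷ rotate-box d es (V ∷ S)

sides-rotate : (d : ℕ) (ds : Vec ℕ m) (S : SubBox (d ∷ ds)) → sides (rotate-box d ds S) ↭ sides S
sides-rotate d []       (V ∷ [])    = ↭-refl
sides-rotate d (e ∷ es) (V ∷ W ∷ S) = ↭-trans (↭-prep _ (sides-rotate d es (V ∷ S))) (↭-swap _ _ ↭-refl)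

rotate-∈⁺ : (d : ℕ) (ds : Vec ℕ m) (c : Point (ds ∷ʳ d)) (S : SubBox (d ∷ ds)) →
  c ∈ᵇ rotate-box d ds S → rotate-point d ds c ∈ᵇ S
rotate-∈⁺ d []       (a ∷ []) (V ∷ [])    c∈ = c∈
rotate-∈⁺ d (e ∷ es) (b ∷ c)  (V ∷ W ∷ S) (b∈ ∷ c∈)
  with rotate-point d es c | rotate-∈⁺ d es c (V ∷ S) c∈
... | a ∷ c′ | a∈ ∷ c′∈ = a∈ ∷ b∈ ∷ c′∈

rotate-∈⁻ : (d : ℕ) (ds : Vec ℕ m) (c : Point (ds ∷ʳ d)) (S : SubBox (d ∷ ds)) →
  rotate-point d ds c ∈ᵇ S → c ∈ᵇ rotate-box d ds S
rotate-∈⁻ d []       (a ∷ []) (V ∷ [])    c∈ = c∈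
rotate-∈⁻ d (e ∷ es) (b ∷ c)  (V ∷ W ∷ S) c∈
  with rotate-point d es c | rotate-∈⁻ d es c (V ∷ S)
... | a ∷ c′ | ih with c∈
... | a∈ ∷ b∈ ∷ c′∈ = b∈ ∷ ih (a∈ ∷ c′∈)

rotate : {t : Vec ℕ (suc m)} {d : ℕ} {ds : Vec ℕ m} → Tiling t (d ∷ ds) → Tiling t (ds ∷ʳ d)
rotate {t = t} {d = d} {ds = ds} (tiling N bs cover) = tiling N (λ j → turn (bs j))
  (pullback {bs = bs} cover (rotate-point d ds) turn
    (λ c B → rotate-∈⁺ d ds c (box B)) (λ c B → rotate-∈⁻ d ds c (box B)))
  where
  turn : Tile t (d ∷ ds) → Tile t (ds ∷ʳ d)
  turn (tile S p) = tile (rotate-box d ds S) (↭-trans (sides-rotate d ds S) p)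

-- The Fibonacci tiling

fibTiling : ∀ k m → Tiling (fibs 0 m) (fibs k m)
fibTiling zero    m       = single ↭-refl
fibTiling (suc k) zero    = single ↭-refl
fibTiling (suc k) (suc m) = subst (Tiling (fibs 0 (suc m))) (sym (fibs-∷ʳ (suc k) m)) (rotate slab)
  where
  -- F_{m+1} is the new side of the shape, first in the box but last in F_1, …, F_{m+1}.
  shift : (fib (suc m) ∷ fibs 0 m) ↭ fibs 0 (suc m)
  shift = subst ((fib (suc m) ∷ fibs 0 m) ↭_) (sym (fibs-∷ʳ 0 m)) (∷↭∷ʳ (fib (suc m)) (fibs 0 m))
  thin : Tiling (fibs 0 (suc m)) (fib (suc m) ∷ fibs (suc k) m)
  thin = reshape shift (extend (fibTiling (suc k) m))
  thick : Tiling (fibs 0 (suc m)) (fib (suc k) ∷ fibs (suc k) m)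
  thick = fibTiling k (suc m)
  -- F_{k+m+2} = F_{k+2}·F_{m+1} + F_m·F_{k+1}
  slab : Tiling (fibs 0 (suc m)) (fib (suc (suc k) + m) ∷ fibs (suc k) m)
  slab = subst (λ s → Tiling (fibs 0 (suc m)) (s ∷ fibs (suc k) m)) (sym (fib-add (suc k) m))
           (union (copies (fib (suc (suc k))) thin) (copies (fib m) thick))

-- From tilings to block partitions of a layer

-- A maximal chain with level sizes D is a point of the box tabulate D.
toPoint : (D : Fin m → ℕ) → ((i : Fin m) → Fin (D i)) → Point (tabulate D)
toPoint {zero}  D c = []
toPoint {suc m} D c = c zero ∷ toPoint (λ i → D (suc i)) (λ i → c (suc i))

levels : (D : Fin m → ℕ) → SubBox (tabulate D) → (i : Fin m) → Subset (D i)
levels D (V ∷ S) zero    = V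
levels D (V ∷ S) (suc i) = levels (λ i → D (suc i)) S i

lookup-sides : (D : Fin m → ℕ) (S : SubBox (tabulate D)) (i : Fin m) → lookup (sides S) i ≡ ∣ levels D S i ∣
lookup-sides D (V ∷ S) zero    = refl
lookup-sides D (V ∷ S) (suc i) = lookup-sides (λ i → D (suc i)) S i

toPoint-∈⁺ : (D : Fin m → ℕ) (c : (i : Fin m) → Fin (D i)) (S : SubBox (tabulate D)) →
  (∀ i → c i ∈ levels D S i) → toPoint D c ∈ᵇ S
toPoint-∈⁺ {zero}  D c []      c∈ = []
toPoint-∈⁺ {suc m} D c (V ∷ S) c∈ = c∈ zero ∷ toPoint-∈⁺ (λ i → D (suc i)) (λ i → c (suc i)) S (λ i → c∈ (suc i))

toPoint-∈⁻ : (D : Fin m → ℕ) (c : (i : Fin m) → Fin (D i)) (S : SubBox (tabulate D)) →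
  toPoint D c ∈ᵇ S → ∀ i → c i ∈ levels D S i
toPoint-∈⁻ D c (V ∷ S) (a∈ ∷ c∈) zero    = a∈
toPoint-∈⁻ D c (V ∷ S) (a∈ ∷ c∈) (suc i) = toPoint-∈⁻ (λ i → D (suc i)) (λ i → c (suc i)) S c∈ i

tiling⇒partition : (F : ℕ → ℕ) (a m : ℕ) →
  Tiling (tabulate (λ (i : Fin m) → F (suc (toℕ i)))) (tabulate (λ i → F (a + toℕ i))) →
  HasBlockPartition F a m
tiling⇒partition F a m (tiling N bs cover) = N , toBlock ∘ bs , partition
  where
  D : Fin m → ℕ
  D i = F (a + toℕ i)
  toBlock : Tile (tabulate (λ i → F (suc (toℕ i)))) (tabulate D) → Block F a m
  toBlock (tile S p) with ↭⇒permutation p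
  ... | σ , σ-sides = record
    { σ     = σ
    ; V     = levels D S
    ; sizes = λ i → begin
        ∣ levels D S i ∣                                ≡⟨ sym (lookup-sides D S i) ⟩
        lookup (sides S) i                              ≡⟨ σ-sides i ⟩
        lookup (tabulate (λ i → F (suc (toℕ i)))) (σ ⟨$⟩ʳ i) ≡⟨ lookup∘tabulate (λ i → F (suc (toℕ i))) _ ⟩
        F (suc (toℕ (σ ⟨$⟩ʳ i)))                        ∎
    }
    where open ≡-Reasoning
  partition : IsBlockPartition F a m (toBlock ∘ bs)
  partition c with cover (toPoint D c)
  ... | j , c∈ , unique = j , toPoint-∈⁻ D c (box (bs j)) c∈ ,
    λ j′ c∈′ → unique j′ (toPoint-∈⁺ D c (box (bs j′)) c∈′)

theorem2 : (k n : ℕ) → k ≤ n → HasBlockPartition fib (suc k) (n ∸ k)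
theorem2 k n _ = tiling⇒partition fib (suc k) (n ∸ k)
  (subst₂ Tiling (sym (tabulate-fibs 0 (n ∸ k) _ λ _ → refl)) (sym (tabulate-fibs k (n ∸ k) _ λ _ → refl))
    (fibTiling k (n ∸ k)))
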